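{- Let $n \ge 2$ and $\sigma\ge2$, let $s$ be a random string of length $n$ with characters drawn independently and uniformly from an alphabet of size $\sigma$, let $r$ be its number of maximal runs, $X = r-1$, and $q = (2-\sigma)/\sigma$. Then the peeling kernel $\mathcal{K}(s)$ contains exactly one distinct symbol if and only if $r$ is odd, if and only if $X$ is even, and contains exactly two distinct symbols otherwise. Hence \[ \Pr\bigl(\mathcal{K}(s)\text{ has exactly one distinct symbol}\bigr) = \tfrac12\bigl(1 + q^{n-1}\bigr), \] which equals $1/2$ exactly for $\sigma = 2$, and tends to $1/2$ exponentially fast in $n$ for $\sigma \ge 3$.
   Context: The maximal runs of a non-empty string $s$ are the blocks of its run-length encoding $s = a_1^{m_1}\cdots a_r^{m_r}$ ($m_i\ge1$, $a_i\ne a_{i+1}$). Let $\texttt{@}$ and $\texttt{\$}$ be two distinct symbols not in the alphabet, and $\hat{s} = \texttt{@}\,s\,\texttt{\$}$. The leading (resp. trailing) run of a non-empty string is its longest prefix (resp. suffix) consisting of a single repeated symbol. The Flashback decomposition $\mathcal{F}(s) = [(\sigma_0,p_0),\ldots,(\sigma_{k-1},p_{k-1})]$ is produced starting with active span $\hat{s}$: (i) if the span is empty, stop; (ii) let $\ell$ be its leading run length; if $\ell$ equals the span length, append (span, $0$) and stop; (iii) otherwise let $\sigma'$ be the leading run followed by the trailing run and the middle the span with both removed; if the middle is empty append $(\sigma',0)$ and stop, else append $(\sigma',\ell)$ and continue on the middle. The peeling kernel is $\mathcal{K}(s) = \sigma_{k-1}$, the symbol string of the last token. -}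

module Defs where

open import Data.Nat as ℕ using (ℕ; zero; suc; _∸_; _≡ᵇ_)
open import Data.Bool using (Bool; true; false; if_then_else_)
open import Data.Fin using (Fin)
import Data.Fin.Properties as FinP
open import Data.List using (List; []; _∷_; length; take; drop; reverse; takeWhile; _++_; map; concatMap; filterᵇ; deduplicate; allFin)
open import Data.Vec using (Vec; toList) renaming ([] to []ᵥ; _∷_ to _∷ᵥ_)
open import Data.Product using (_×_; _,_; proj₁)
open import Data.Integer as ℤ using (ℤ; +_)
open import Data.Rational as ℚ using (ℚ)
open import Relation.Binary.PropositionalEquality using (_≡_; refl; cong)
open import Relation.Nullary using (Dec; yes; no; does; ¬_)
open import Relation.Nullary.Decidable using (⌊_⌋)

-- Symbols of the padded string  ŝ = @ s $  over the alphabet Fin σ.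

data Sym (σ : ℕ) : Set where
  at     : Sym σ
  dollar : Sym σ
  ch     : Fin σ → Sym σ

ch-inj : ∀ {σ} {a b : Fin σ} → ch a ≡ ch b → a ≡ b
ch-inj refl = refl

_≟ₛ_ : ∀ {σ} (x y : Sym σ) → Dec (x ≡ y)
at ≟ₛ at = yes refl
at ≟ₛ dollar = no λ ()
at ≟ₛ ch _ = no λ ()
dollar ≟ₛ at = no λ ()
dollar ≟ₛ dollar = yes refl
dollar ≟ₛ ch _ = no λ ()
ch _ ≟ₛ at = no λ ()
ch _ ≟ₛ dollar = no λ ()
ch a ≟ₛ ch b with a FinP.≟ b
... | yes refl = yes refl
... | no a≢b = no λ e → a≢b (ch-inj e)

hat : ∀ {σ n} → Vec (Fin σ) n → List (Sym σ)
hat s = at ∷ (map ch (toList s) ++ (dollar ∷ []))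

module _ {σ : ℕ} where

  leadingRun : List (Sym σ) → List (Sym σ)
  leadingRun [] = []
  leadingRun (x ∷ xs) = x ∷ takeWhile (λ y → x ≟ₛ y) xs

  trailingRun : List (Sym σ) → List (Sym σ)
  trailingRun xs = reverse (leadingRun (reverse xs))

  -- Flashback decomposition, with fuel (fuel = length of the span suffices,
  -- since every continuing step removes at least one symbol).
  flashbackAux : ℕ → List (Sym σ) → List (List (Sym σ) × ℕ)
  flashbackAux zero _ = []
  flashbackAux (suc k) [] = []
  flashbackAux (suc k) span@(_ ∷ _) =
    let ℓ      = length (leadingRun span)
        lead   = take ℓ span
        rest   = drop ℓ span
        trail  = trailingRun rest
        middle = take (length rest ∸ length trail) rest
    in if ℓ ≡ᵇ length span
       then (span , 0) ∷ []
       else (case-middle middle (lead ++ trail) ℓ)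
    where
      case-middle : List (Sym σ) → List (Sym σ) → ℕ → List (List (Sym σ) × ℕ)
      case-middle [] σ' ℓ = (σ' , 0) ∷ []
      case-middle m@(_ ∷ _) σ' ℓ = (σ' , ℓ) ∷ flashbackAux k m

  flashback : List (Sym σ) → List (List (Sym σ) × ℕ)
  flashback span = flashbackAux (length span) span

  -- symbol string of the last token (default [] for an empty list, which
  -- never occurs for a non-empty span)
  lastSymbols : List (List (Sym σ) × ℕ) → List (Sym σ)
  lastSymbols [] = []
  lastSymbols (t ∷ []) = proj₁ t
  lastSymbols (_ ∷ ts@(_ ∷ _)) = lastSymbols ts

  distinct : List (Sym σ) → ℕ
  distinct xs = length (deduplicate _≟ₛ_ xs)

-- Peeling kernel  K(s) = σ_{k-1}  of  F(s), computed on ŝ = @ s $.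
kernel : ∀ {σ n} → Vec (Fin σ) n → List (Sym σ)
kernel s = lastSymbols (flashback (hat s))

runsL : ∀ {σ} → List (Fin σ) → ℕ
runsL [] = 0
runsL (x ∷ []) = 1
runsL (x ∷ xs@(y ∷ _)) = if ⌊ x FinP.≟ y ⌋ then runsL xs else suc (runsL xs)

runs : ∀ {σ n} → Vec (Fin σ) n → ℕ
runs s = runsL (toList s)

-- Uniform distribution on strings of length n over Fin σ:
-- enumerate all σ^n strings, probability = (#favourable) / σ^n.

allStrings : (σ n : ℕ) → List (Vec (Fin σ) n)
allStrings σ zero = []ᵥ ∷ []
allStrings σ (suc n) = concatMap (λ a → map (a ∷ᵥ_) (allStrings σ n)) (allFin σ)

-- a / d as a rational (d = 0 is never used; it is mapped to 0)
frac : ℤ → ℕ → ℚ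
frac a zero = ℚ.0ℚ
frac a (suc d) = a ℚ./ suc d

prob : (σ n : ℕ) → (Vec (Fin σ) n → Bool) → ℚ
prob σ n P = frac (+ length (filterᵇ P (allStrings σ n))) (σ ℕ.^ n)

_^ℚ_ : ℚ → ℕ → ℚ
q ^ℚ zero = ℚ.1ℚ
q ^ℚ suc k = q ℚ.* (q ^ℚ k)

open import Data.Nat.Divisibility using (_∣_)

Even : ℕ → Set
Even m = 2 ∣ m

Odd : ℕ → Set
Odd m = 2 ∣ suc m

{-# OPTIONS --safe #-}
module Submission where

-- A step of the Flashback decomposition that does not stop removes the leading
-- and the trailing run of a span with at least three runs, so it lowers the
-- number of runs by exactly two; the last token is a span with one or two
-- runs, and such a string has as many distinct symbols as runs. Since
-- ŝ = @ s $ has r + 2 runs, the kernel has one distinct symbol if r is odd and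
-- two otherwise.
--
-- For the probability, let f_m(β) be the number of strings t of length m for
-- which a t has an odd number of runs iff β. Splitting on the first letter of t
-- gives f_{m+1}(β) = f_m(β) + (σ - 1) f_m(¬β), independently of a, hence
-- f_m(odd) + f_m(even) = σ^m and f_m(odd) - f_m(even) = (2 - σ)^m. There are
-- σ f_{n-1}(odd) favourable strings, i.e. a fraction ½ (1 + q^(n-1)).

open import Relation.Unary using (Decidable)
open import Relation.Binary.Definitions using (DecidableEquality)

module Parity where

  open import Defs using (Odd; Even)
  open import Data.Bool using (Bool; true; false; not)
  open import Data.Bool.Properties using (not-involutive)
  open import Data.Empty using (⊥-elim)
  open import Data.Nat using (ℕ; zero; suc; _+_)
  open import Data.Nat.Divisibility using (divides; ∣m+n∣m⇒∣n; ∣m∣n⇒∣m+n; ∣-refl)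
  open import Function using (_∘_)
  open import Function.Bundles using (_⇔_; mk⇔)
  import Function.Properties.Equivalence as ⇔
  open import Relation.Binary.PropositionalEquality using (_≡_; refl)
  open import Relation.Nullary using (¬_)

  isOdd : ℕ → Bool
  isOdd zero = false
  isOdd (suc n) = not (isOdd n)

  isOdd-+2 : ∀ n → isOdd (2 + n) ≡ isOdd n
  isOdd-+2 n = not-involutive (isOdd n)

  Even-+2 : ∀ n → Even (2 + n) ⇔ Even n
  Even-+2 n = mk⇔ (λ 2∣2+n → ∣m+n∣m⇒∣n 2∣2+n ∣-refl) (∣m∣n⇒∣m+n ∣-refl)

  ¬Odd0 : ¬ Odd 0
  ¬Odd0 (divides (suc _) ())

  isOdd⇔Odd : ∀ n → isOdd n ≡ true ⇔ Odd n
  isOdd⇔Odd zero = mk⇔ (λ ()) (⊥-elim ∘ ¬Odd0)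
  isOdd⇔Odd (suc zero) = mk⇔ (λ _ → ∣-refl) (λ _ → refl)
  isOdd⇔Odd (suc (suc n)) rewrite isOdd-+2 n = ⇔.trans (isOdd⇔Odd n) (⇔.sym (Even-+2 (suc n)))

module TakeWhile {a p} {A : Set a} {P : A → Set p} (P? : Decidable P) where

  open import Data.Bool using (true; false)
  open import Data.List using ([]; _∷_; length; take; drop; takeWhile; dropWhile; null)
  open import Data.List.Properties using (length-++; takeWhile++dropWhile)
  open import Data.Nat using (_≤_; _≡ᵇ_)
  open import Data.Nat.Properties using (m≤n+m)
  open import Relation.Binary.PropositionalEquality using (_≡_; refl; cong; subst; trans; sym)
  open import Relation.Nullary using (does)

  take-length-takeWhile : ∀ xs → take (length (takeWhile P? xs)) xs ≡ takeWhile P? xs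
  take-length-takeWhile [] = refl
  take-length-takeWhile (x ∷ xs) with does (P? x)
  ... | true = cong (x ∷_) (take-length-takeWhile xs)
  ... | false = refl

  drop-length-takeWhile : ∀ xs → drop (length (takeWhile P? xs)) xs ≡ dropWhile P? xs
  drop-length-takeWhile [] = refl
  drop-length-takeWhile (x ∷ xs) with does (P? x)
  ... | true = drop-length-takeWhile xs
  ... | false = refl

  length-takeWhile-≡ᵇ : ∀ xs → (length (takeWhile P? xs) ≡ᵇ length xs) ≡ null (dropWhile P? xs)
  length-takeWhile-≡ᵇ [] = refl
  length-takeWhile-≡ᵇ (x ∷ xs) with does (P? x)
  ... | true = length-takeWhile-≡ᵇ xs
  ... | false = refl

  length-dropWhile≤ : ∀ xs → length (dropWhile P? xs) ≤ length xs
  length-dropWhile≤ xs = subst (length (dropWhile P? xs) ≤_)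
    (trans (sym (length-++ (takeWhile P? xs))) (cong length (takeWhile++dropWhile P? xs))) (m≤n+m _ _)

module Runs {a} {A : Set a} (_≟_ : DecidableEquality A) where

  open import Data.Bool using (if_then_else_)
  open import Data.Empty using (⊥-elim)
  open import Data.List using (List; []; _∷_; _++_; _∷ʳ_; length; reverse; takeWhile; dropWhile; filter; deduplicate; head)
  open import Data.List.Properties using (takeWhile++dropWhile; unfold-reverse; filter-none; filter-reject; filter-accept; filter-idem)
  open import Data.List.Relation.Unary.All as All using (All; []; _∷_)
  open import Data.List.Relation.Unary.All.Properties using (all-takeWhile; dropWhile⁻; all-head-dropWhile; deduplicate⁺)
  import Data.Maybe.Relation.Unary.All as Maybe
  open import Data.Nat using (ℕ; suc; _+_; _≤_; z≤n; s≤s)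
  open import Data.Nat.Properties using (+-assoc; +-comm; ≤-trans; <-irrefl)
  open import Function using (_∘_)
  open import Relation.Binary.PropositionalEquality
  open import Relation.Nullary using (yes; no; does; ¬?)
  open import Relation.Nullary.Decidable using (dec-true; dec-false)

  boundary : A → A → ℕ
  boundary x y = if does (x ≟ y) then 0 else 1

  countRuns : List A → ℕ
  countRuns [] = 0
  countRuns (x ∷ []) = 1
  countRuns (x ∷ xs@(y ∷ _)) = boundary x y + countRuns xs

  boundary-≡ : ∀ x → boundary x x ≡ 0
  boundary-≡ x rewrite dec-true (x ≟ x) refl = refl

  boundary-≢ : ∀ {x y} → x ≢ y → boundary x y ≡ 1
  boundary-≢ {x} {y} x≢y rewrite dec-false (x ≟ y) x≢y = refl

  boundary-sym : ∀ x y → boundary x y ≡ boundary y x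
  boundary-sym x y with x ≟ y
  ... | yes refl = sym (boundary-≡ x)
  ... | no x≢y = sym (boundary-≢ (x≢y ∘ sym))

  countRuns-∷-dropWhile : ∀ x xs → countRuns (x ∷ xs) ≡ suc (countRuns (dropWhile (x ≟_) xs))
  countRuns-∷-dropWhile x [] = refl
  countRuns-∷-dropWhile x (y ∷ ys) with x ≟ y
  ... | yes refl = countRuns-∷-dropWhile x ys
  ... | no _ = refl

  countRuns-∷-pos : ∀ x xs → 1 ≤ countRuns (x ∷ xs)
  countRuns-∷-pos x xs rewrite countRuns-∷-dropWhile x xs = s≤s z≤n

  countRuns-∷ʳ-∷ʳ : ∀ xs y z → countRuns (xs ∷ʳ y ∷ʳ z) ≡ countRuns (xs ∷ʳ y) + boundary y z
  countRuns-∷ʳ-∷ʳ [] y z = +-comm (boundary y z) 1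
  countRuns-∷ʳ-∷ʳ (x ∷ []) y z = begin
    boundary x y + (boundary y z + 1)  ≡⟨ cong (boundary x y +_) (+-comm (boundary y z) 1) ⟩
    boundary x y + suc (boundary y z)  ≡⟨ sym (+-assoc (boundary x y) 1 (boundary y z)) ⟩
    boundary x y + 1 + boundary y z    ∎
    where open ≡-Reasoning
  countRuns-∷ʳ-∷ʳ (x ∷ xs@(w ∷ _)) y z =
    trans (cong (boundary x w +_) (countRuns-∷ʳ-∷ʳ xs y z)) (sym (+-assoc (boundary x w) _ _))

  countRuns-reverse : ∀ xs → countRuns (reverse xs) ≡ countRuns xs
  countRuns-reverse [] = refl
  countRuns-reverse (x ∷ []) = refl
  countRuns-reverse (x ∷ xs@(y ∷ ys)) = begin
    countRuns (reverse (x ∷ xs))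
      ≡⟨ cong countRuns (trans (unfold-reverse x xs) (cong (_∷ʳ x) (unfold-reverse y ys))) ⟩
    countRuns (reverse ys ∷ʳ y ∷ʳ x)
      ≡⟨ countRuns-∷ʳ-∷ʳ (reverse ys) y x ⟩
    countRuns (reverse ys ∷ʳ y) + boundary y x
      ≡⟨ cong₂ _+_ (trans (cong countRuns (sym (unfold-reverse y ys))) (countRuns-reverse xs)) (boundary-sym y x) ⟩
    countRuns xs + boundary x y
      ≡⟨ +-comm (countRuns xs) (boundary x y) ⟩
    countRuns (x ∷ xs) ∎
    where open ≡-Reasoning

  takeWhile-++-dropWhile≡ : ∀ x xs {rest} → dropWhile (x ≟_) xs ≡ rest → takeWhile (x ≟_) xs ++ rest ≡ xs
  takeWhile-++-dropWhile≡ x xs refl = takeWhile++dropWhile (x ≟_) xs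

  dropWhile≡∷⇒≢ : ∀ x xs {w ws} → dropWhile (x ≟_) xs ≡ w ∷ ws → x ≢ w
  dropWhile≡∷⇒≢ x xs rest≡ with subst (Maybe.All _ ∘ head) rest≡ (all-head-dropWhile (x ≟_) xs)
  ... | Maybe.just x≢w = x≢w

  filter-≢-deduplicate : ∀ {x xs} → All (x ≡_) xs → filter (¬? ∘ (x ≟_)) (deduplicate _≟_ xs) ≡ []
  filter-≢-deduplicate {x} x≡xs =
    filter-none (¬? ∘ (x ≟_)) (All.map (λ x≡y x≢y → x≢y x≡y) (deduplicate⁺ _≟_ x≡xs))

  deduplicate-∷-∷ : ∀ x xs → deduplicate _≟_ (x ∷ x ∷ xs) ≡ deduplicate _≟_ (x ∷ xs)
  deduplicate-∷-∷ x xs = cong (x ∷_)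
    (trans (filter-reject (¬? ∘ (x ≟_)) {xs = filter (¬? ∘ (x ≟_)) (deduplicate _≟_ xs)} (λ x≢x → x≢x refl))
           (filter-idem (¬? ∘ (x ≟_)) (deduplicate _≟_ xs)))

  deduplicate-one-run : ∀ {x xs} → All (x ≡_) xs → deduplicate _≟_ (x ∷ xs) ≡ x ∷ []
  deduplicate-one-run x≡xs = cong (_ ∷_) (filter-≢-deduplicate x≡xs)

  deduplicate-two-runs : ∀ {x y xs ys} → x ≢ y → All (x ≡_) xs → All (y ≡_) ys →
                         deduplicate _≟_ (x ∷ xs ++ y ∷ ys) ≡ x ∷ y ∷ []
  deduplicate-two-runs {x} x≢y [] y≡ys rewrite filter-≢-deduplicate y≡ys =
    cong (x ∷_) (filter-accept (¬? ∘ (x ≟_)) x≢y)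
  deduplicate-two-runs {x} {y} {_ ∷ xs} {ys} x≢y (refl ∷ x≡xs) y≡ys =
    trans (deduplicate-∷-∷ x (xs ++ y ∷ ys)) (deduplicate-two-runs x≢y x≡xs y≡ys)

  length-deduplicate-countRuns : ∀ xs → countRuns xs ≤ 2 → length (deduplicate _≟_ xs) ≡ countRuns xs
  length-deduplicate-countRuns [] _ = refl
  length-deduplicate-countRuns (x ∷ xs) runs≤2
    with dropWhile (x ≟_) xs in rest≡ | countRuns-∷-dropWhile x xs
  ... | [] | runs≡1 =
    trans (cong length (deduplicate-one-run (dropWhile⁻ {xs = xs} (x ≟_) rest≡))) (sym runs≡1)
  ... | w ∷ ws | runs≡
    with dropWhile (w ≟_) ws in rest′≡ | countRuns-∷-dropWhile w ws
  ...   | [] | runs′≡1 = begin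
    length (deduplicate _≟_ (x ∷ xs))
      ≡⟨ cong (length ∘ deduplicate _≟_ ∘ (x ∷_)) (sym (takeWhile-++-dropWhile≡ x xs rest≡)) ⟩
    length (deduplicate _≟_ (x ∷ takeWhile (x ≟_) xs ++ w ∷ ws))
      ≡⟨ cong length (deduplicate-two-runs (dropWhile≡∷⇒≢ x xs rest≡) (all-takeWhile (x ≟_) xs)
                                           (dropWhile⁻ {xs = ws} (w ≟_) rest′≡)) ⟩
    2
      ≡⟨ sym (trans runs≡ (cong suc runs′≡1)) ⟩
    countRuns (x ∷ xs) ∎
    where open ≡-Reasoning
  ...   | u ∷ us | runs′≡ = ⊥-elim (<-irrefl refl (≤-trans (s≤s (s≤s (countRuns-∷-pos u us)))
                                                         (subst (_≤ 2) (trans runs≡ (cong suc runs′≡)) runs≤2)))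

module Peeling where

  open import Defs
  open import Data.Bool using (true; false; if_then_else_)
  open import Data.Empty using (⊥-elim)
  open import Data.Fin using (Fin)
  import Data.Fin.Properties as Fin
  open import Data.List using (List; []; _∷_; _++_; _∷ʳ_; length; map; reverse; take; takeWhile; dropWhile; deduplicate; null)
  open import Data.List.Properties using (takeWhile++dropWhile; reverse-involutive; reverse-++; length-reverse; length-++)
  open import Data.Nat using (ℕ; suc; _+_; _∸_; _≤_; z≤n; s≤s)
  open import Data.Nat.Properties using (m+n∸n≡m; m≤m+n; ≤-refl; ≤-trans)
  open import Data.Product using (_×_; _,_)
  open import Data.Vec using (Vec; toList) renaming (_∷_ to _∷ᵥ_)
  open import Function using (_∘_)
  open import Function.Bundles using (_⇔_; mk⇔; Equivalence)
  import Function.Properties.Equivalence as ⇔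
  open import Relation.Binary.PropositionalEquality
  open import Relation.Nullary using (¬_; yes; no)
  open Parity

  kernelRuns : ℕ → ℕ
  kernelRuns r = if isOdd r then 1 else 2

  kernelRuns-+2 : ∀ r → kernelRuns (2 + r) ≡ kernelRuns r
  kernelRuns-+2 r = cong (if_then 1 else 2) (isOdd-+2 r)

  kernelRuns≤2 : ∀ r → kernelRuns r ≤ 2
  kernelRuns≤2 r with isOdd r
  ... | true = s≤s z≤n
  ... | false = ≤-refl

  kernelRuns≡1⇔Odd : ∀ r → kernelRuns r ≡ 1 ⇔ Odd r
  kernelRuns≡1⇔Odd r = ⇔.trans (mk⇔ to (cong (if_then 1 else 2))) (isOdd⇔Odd r)
    where
    to : kernelRuns r ≡ 1 → isOdd r ≡ true
    to k≡1 with isOdd r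
    ... | true = refl
    ... | false with () ← k≡1

  ¬Odd⇒kernelRuns≡2 : ∀ r → ¬ Odd r → kernelRuns r ≡ 2
  ¬Odd⇒kernelRuns≡2 r ¬odd with isOdd r in odd
  ... | true = ⊥-elim (¬odd (Equivalence.to (isOdd⇔Odd r) odd))
  ... | false = refl

  Odd⇔Even-∸1 : ∀ {r} → 1 ≤ r → Odd r ⇔ Even (r ∸ 1)
  Odd⇔Even-∸1 {suc r} _ = Even-+2 r

  module _ {σ : ℕ} where

    open Runs (_≟ₛ_ {σ})
    open TakeWhile

    middle : List (Sym σ) → List (Sym σ)
    middle rest = take (length rest ∸ length (trailingRun rest)) rest

    module _ {xs : List (Sym σ)} {y : Sym σ} {ys : List (Sym σ)} (rev≡ : reverse xs ≡ y ∷ ys) where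

      trailingRun-reverse : trailingRun xs ≡ reverse (y ∷ takeWhile (y ≟ₛ_) ys)
      trailingRun-reverse = cong (reverse ∘ leadingRun) rev≡

      reverse-dropWhile-++-trailingRun : reverse (dropWhile (y ≟ₛ_) ys) ++ trailingRun xs ≡ xs
      reverse-dropWhile-++-trailingRun = begin
        reverse (dropWhile (y ≟ₛ_) ys) ++ trailingRun xs
          ≡⟨ cong (reverse (dropWhile (y ≟ₛ_) ys) ++_) trailingRun-reverse ⟩
        reverse (dropWhile (y ≟ₛ_) ys) ++ reverse (y ∷ takeWhile (y ≟ₛ_) ys)
          ≡⟨ sym (reverse-++ (y ∷ takeWhile (y ≟ₛ_) ys) (dropWhile (y ≟ₛ_) ys)) ⟩
        reverse (y ∷ takeWhile (y ≟ₛ_) ys ++ dropWhile (y ≟ₛ_) ys)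
          ≡⟨ cong (reverse ∘ (y ∷_)) (takeWhile++dropWhile (y ≟ₛ_) ys) ⟩
        reverse (y ∷ ys)
          ≡⟨ cong reverse (sym rev≡) ⟩
        reverse (reverse xs)
          ≡⟨ reverse-involutive xs ⟩
        xs ∎
        where open ≡-Reasoning

      middle-reverse : middle xs ≡ reverse (dropWhile (y ≟ₛ_) ys)
      middle-reverse = begin
        take (length xs ∸ length T) xs
          ≡⟨ cong (λ zs → take (length zs ∸ length T) zs) (sym reverse-dropWhile-++-trailingRun) ⟩
        take (length (M ++ T) ∸ length T) (M ++ T)
          ≡⟨ cong (λ n → take (n ∸ length T) (M ++ T)) (length-++ M) ⟩
        take (length M + length T ∸ length T) (M ++ T)
          ≡⟨ cong (λ n → take n (M ++ T)) (m+n∸n≡m (length M) (length T)) ⟩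
        take (length M) (M ++ T)
          ≡⟨ take-length-++ M T ⟩
        M ∎
        where
        open ≡-Reasoning
        M = reverse (dropWhile (y ≟ₛ_) ys)
        T = trailingRun xs
        take-length-++ : ∀ (us vs : List (Sym σ)) → take (length us) (us ++ vs) ≡ us
        take-length-++ [] vs = refl
        take-length-++ (u ∷ us) vs = cong (u ∷_) (take-length-++ us vs)

    middle-++-trailingRun : ∀ xs → middle xs ++ trailingRun xs ≡ xs
    middle-++-trailingRun xs = split (reverse xs) refl
      where
      split : ∀ r → reverse xs ≡ r → middle xs ++ trailingRun xs ≡ xs
      split [] rev≡ = subst (λ zs → middle zs ++ trailingRun zs ≡ zs)
                            (trans (cong reverse (sym rev≡)) (reverse-involutive xs)) refl
      split (y ∷ ys) rev≡ =
        trans (cong (_++ trailingRun xs) (middle-reverse rev≡)) (reverse-dropWhile-++-trailingRun rev≡)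

    length-middle≤ : ∀ xs → length (middle xs) ≤ length xs
    length-middle≤ xs = subst (length (middle xs) ≤_)
      (trans (sym (length-++ (middle xs))) (cong length (middle-++-trailingRun xs))) (m≤m+n _ _)

    countRuns-middle : ∀ x xs → countRuns (x ∷ xs) ≡ suc (countRuns (middle (x ∷ xs)))
    countRuns-middle x xs = split (reverse (x ∷ xs)) refl
      where
      split : ∀ r → reverse (x ∷ xs) ≡ r → countRuns (x ∷ xs) ≡ suc (countRuns (middle (x ∷ xs)))
      split [] rev≡ with () ← trans (sym (length-reverse (x ∷ xs))) (cong length rev≡)
      split (y ∷ ys) rev≡ = begin
        countRuns (x ∷ xs)                   ≡⟨ sym (countRuns-reverse (x ∷ xs)) ⟩
        countRuns (reverse (x ∷ xs))         ≡⟨ cong countRuns rev≡ ⟩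
        countRuns (y ∷ ys)                   ≡⟨ countRuns-∷-dropWhile y ys ⟩
        suc (countRuns M)                    ≡⟨ cong suc (sym (countRuns-reverse M)) ⟩
        suc (countRuns (reverse M))          ≡⟨ cong (suc ∘ countRuns) (sym (middle-reverse {xs = x ∷ xs} rev≡)) ⟩
        suc (countRuns (middle (x ∷ xs)))    ∎
        where
        open ≡-Reasoning
        M = dropWhile (y ≟ₛ_) ys

    -- The local function case-middle of flashbackAux, which cannot be named here.
    peelStep : ℕ → List (Sym σ) → List (Sym σ) → ℕ → List (List (Sym σ) × ℕ)
    peelStep k [] σ′ ℓ = (σ′ , 0) ∷ []
    peelStep k m@(_ ∷ _) σ′ ℓ = (σ′ , ℓ) ∷ flashbackAux k m

    flashbackAux-∷ : ∀ k x xs →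
      flashbackAux (suc k) (x ∷ xs) ≡
        (if null (dropWhile (x ≟ₛ_) xs) then (x ∷ xs , 0) ∷ []
         else peelStep k (middle (dropWhile (x ≟ₛ_) xs))
                         (x ∷ takeWhile (x ≟ₛ_) xs ++ trailingRun (dropWhile (x ≟ₛ_) xs))
                         (suc (length (takeWhile (x ≟ₛ_) xs))))
    flashbackAux-∷ k x xs
      rewrite take-length-takeWhile (x ≟ₛ_) xs | drop-length-takeWhile (x ≟ₛ_) xs
            | length-takeWhile-≡ᵇ (x ≟ₛ_) xs
      with middle (dropWhile (x ≟ₛ_) xs)
    ... | [] = refl
    ... | _ ∷ _ = refl

    lastSymbols-∷-flashbackAux : ∀ t k (x : Sym σ) xs → length (x ∷ xs) ≤ k →
      lastSymbols (t ∷ flashbackAux k (x ∷ xs)) ≡ lastSymbols (flashbackAux k (x ∷ xs))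
    lastSymbols-∷-flashbackAux t (suc k) x xs _
      rewrite flashbackAux-∷ k x xs
      with null (dropWhile (x ≟ₛ_) xs) | middle (dropWhile (x ≟ₛ_) xs)
    ... | true | _ = refl
    ... | false | [] = refl
    ... | false | _ ∷ _ = refl

    countRuns-lastSymbols-flashbackAux : ∀ k (x : Sym σ) xs → length (x ∷ xs) ≤ k →
      countRuns (lastSymbols (flashbackAux k (x ∷ xs))) ≡ kernelRuns (countRuns (x ∷ xs))
    countRuns-lastSymbols-flashbackAux (suc k) x xs (s≤s |xs|≤k)
      rewrite flashbackAux-∷ k x xs
      with dropWhile (x ≟ₛ_) xs in rest≡ | countRuns-∷-dropWhile x xs | length-dropWhile≤ (x ≟ₛ_) xs
    ... | [] | runs≡1 | _ = trans runs≡1 (cong kernelRuns (sym runs≡1))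
    ... | w ∷ ws | runs≡ | |rest|≤k
      with middle (w ∷ ws) in middle≡ | countRuns-middle w ws | length-middle≤ (w ∷ ws)
    ...   | [] | runs′≡1 | _ = trans (cong countRuns span≡) (trans runs≡2 (cong kernelRuns (sym runs≡2)))
      where
      runs≡2 : countRuns (x ∷ xs) ≡ 2
      runs≡2 = trans runs≡ (cong suc runs′≡1)
      trailingRun≡ : trailingRun (w ∷ ws) ≡ w ∷ ws
      trailingRun≡ = trans (cong (_++ trailingRun (w ∷ ws)) (sym middle≡)) (middle-++-trailingRun (w ∷ ws))
      span≡ : x ∷ takeWhile (x ≟ₛ_) xs ++ trailingRun (w ∷ ws) ≡ x ∷ xs
      span≡ = cong (x ∷_) (trans (cong (takeWhile (x ≟ₛ_) xs ++_) trailingRun≡) (takeWhile-++-dropWhile≡ x xs rest≡))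
    ...   | m ∷ ms | runs′≡ | |middle|≤ = begin
      countRuns (lastSymbols (_ ∷ flashbackAux k (m ∷ ms))) ≡⟨ cong countRuns (lastSymbols-∷-flashbackAux _ k m ms bound) ⟩
      countRuns (lastSymbols (flashbackAux k (m ∷ ms)))     ≡⟨ countRuns-lastSymbols-flashbackAux k m ms bound ⟩
      kernelRuns (countRuns (m ∷ ms))                       ≡⟨ sym (kernelRuns-+2 (countRuns (m ∷ ms))) ⟩
      kernelRuns (2 + countRuns (m ∷ ms))                   ≡⟨ cong kernelRuns (sym (trans runs≡ (cong suc runs′≡))) ⟩
      kernelRuns (countRuns (x ∷ xs))                       ∎
      where
      open ≡-Reasoning
      bound : length (m ∷ ms) ≤ k
      bound = ≤-trans |middle|≤ (≤-trans |rest|≤k |xs|≤k)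

    countRuns-map-ch-∷ʳ-dollar : ∀ a (l : List (Fin σ)) → countRuns (map ch (a ∷ l) ∷ʳ dollar) ≡ suc (runsL (a ∷ l))
    countRuns-map-ch-∷ʳ-dollar a [] = refl
    countRuns-map-ch-∷ʳ-dollar a (b ∷ l) with a Fin.≟ b
    ... | yes refl = countRuns-map-ch-∷ʳ-dollar a l
    ... | no _ = cong suc (countRuns-map-ch-∷ʳ-dollar b l)

    countRuns-hat : ∀ {n} (s : Vec (Fin σ) n) → countRuns (hat s) ≡ 2 + runs s
    countRuns-hat s with toList s
    ... | [] = refl
    ... | a ∷ l = cong suc (countRuns-map-ch-∷ʳ-dollar a l)

    distinct-kernel : ∀ {n} (s : Vec (Fin σ) n) → distinct (kernel s) ≡ kernelRuns (runs s)
    distinct-kernel s = begin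
      length (deduplicate _≟ₛ_ (kernel s)) ≡⟨ length-deduplicate-countRuns (kernel s) runs≤2 ⟩
      countRuns (kernel s)                  ≡⟨ runs≡ ⟩
      kernelRuns (countRuns (hat s))        ≡⟨ cong kernelRuns (countRuns-hat s) ⟩
      kernelRuns (2 + runs s)               ≡⟨ kernelRuns-+2 (runs s) ⟩
      kernelRuns (runs s)                   ∎
      where
      open ≡-Reasoning
      runs≡ : countRuns (kernel s) ≡ kernelRuns (countRuns (hat s))
      runs≡ = countRuns-lastSymbols-flashbackAux (length (hat s)) at (map ch (toList s) ∷ʳ dollar) ≤-refl
      runs≤2 : countRuns (kernel s) ≤ 2
      runs≤2 = subst (_≤ 2) (sym runs≡) (kernelRuns≤2 (countRuns (hat s)))

  runsL-∷-pos : ∀ {σ} (a : Fin σ) l → 1 ≤ runsL (a ∷ l)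
  runsL-∷-pos a [] = s≤s z≤n
  runsL-∷-pos a (b ∷ l) with a Fin.≟ b
  ... | yes _ = runsL-∷-pos b l
  ... | no _ = s≤s z≤n

  distinct-kernel-parity : ∀ {σ n} (s : Vec (Fin σ) (suc n)) →
      (distinct (kernel s) ≡ 1 ⇔ Odd (runs s))
    × (Odd (runs s) ⇔ Even (runs s ∸ 1))
    × (¬ Odd (runs s) → distinct (kernel s) ≡ 2)
  distinct-kernel-parity s@(a ∷ᵥ t) rewrite distinct-kernel s =
    kernelRuns≡1⇔Odd (runs s) , Odd⇔Even-∸1 (runsL-∷-pos a (toList t)) , ¬Odd⇒kernelRuns≡2 (runs s)

module Counting where

  open import Defs
  open import Data.Nat.Properties using (+-0-commutativeMonoid)
  open import Algebra.Properties.CommutativeMonoid.Sum +-0-commutativeMonoid using (sum; sum-remove; sum-cong-≗)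
  open import Data.Bool using (Bool; true; false; not; if_then_else_; T?)
  import Data.Bool.Properties as Bool
  open import Data.Empty using (⊥-elim)
  open import Data.Fin using (Fin; punchIn) renaming (zero to fzero; suc to fsuc)
  import Data.Fin.Properties as Fin
  open import Data.Integer as ℤ using (+_)
  open import Data.Integer.Properties using (pos-+; pos-*)
  import Data.Integer.Solver as ℤ-Solver
  open import Data.List using (List; []; _∷_; _++_; length; map; filterᵇ; concatMap; tabulate)
  open import Data.List.Properties using (filter-++; length-++)
  open import Data.Nat using (ℕ; zero; suc; _+_; _*_; _^_; _≡ᵇ_)
  import Data.Nat.Solver as ℕ-Solver
  open import Data.Vec using (Vec; toList) renaming (_∷_ to _∷ᵥ_)
  open import Data.Vec.Functional using (Vector)
  open import Function using (_∘_; id)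
  open import Relation.Binary.PropositionalEquality
  open import Relation.Nullary using (yes; no; does)
  open Parity
  open Peeling using (distinct-kernel)

  count : ∀ {a} {A : Set a} → (A → Bool) → List A → ℕ
  count p = length ∘ filterᵇ p

  module _ {a} {A : Set a} where

    count-++ : ∀ p (xs ys : List A) → count p (xs ++ ys) ≡ count p xs + count p ys
    count-++ p xs ys = trans (cong length (filter-++ (T? ∘ p) xs ys)) (length-++ (filterᵇ p xs))

    count-cong : ∀ {p q} → (∀ x → p x ≡ q x) → (xs : List A) → count p xs ≡ count q xs
    count-cong p≗q [] = refl
    count-cong {p} {q} p≗q (x ∷ xs) with p x | q x | p≗q x
    ... | true | true | _ = cong suc (count-cong p≗q xs)
    ... | false | false | _ = count-cong p≗q xs

    module _ {b} {B : Set b} where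

      count-map : ∀ p (f : B → A) xs → count p (map f xs) ≡ count (p ∘ f) xs
      count-map p f [] = refl
      count-map p f (x ∷ xs) with p (f x)
      ... | true = cong suc (count-map p f xs)
      ... | false = count-map p f xs

      count-concatMap-tabulate : ∀ p (h : B → List A) {n} (g : Fin n → B) →
                                 count p (concatMap h (tabulate g)) ≡ sum (λ i → count p (h (g i)))
      count-concatMap-tabulate p h {zero} g = refl
      count-concatMap-tabulate p h {suc n} g =
        trans (count-++ p (h (g fzero)) _) (cong (_+_ (count p (h (g fzero)))) (count-concatMap-tabulate p h (g ∘ fsuc)))

  ∑-const : ∀ n {t : Vector ℕ n} y → (∀ i → t i ≡ y) → sum t ≡ n * y
  ∑-const zero y t≡y = refl
  ∑-const (suc n) y t≡y = cong₂ _+_ (t≡y fzero) (∑-const n y (t≡y ∘ fsuc))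

  ∑-single-out : ∀ {n} (t : Vector ℕ (suc n)) i y → (∀ j → j ≢ i → t j ≡ y) → sum t ≡ t i + n * y
  ∑-single-out {n} t i y t≡y = trans (sum-remove {i = i} t)
    (cong (_+_ (t i)) (∑-const n y (λ j → t≡y (punchIn i j) (Fin.punchInᵢ≢i i j))))

  count-allStrings-suc : ∀ σ m p →
    count p (allStrings σ (suc m)) ≡ sum (λ a → count (p ∘ (a ∷ᵥ_)) (allStrings σ m))
  count-allStrings-suc σ m p = trans (count-concatMap-tabulate p (λ a → map (a ∷ᵥ_) (allStrings σ m)) id)
    (sum-cong-≗ (λ a → count-map p (a ∷ᵥ_) (allStrings σ m)))

  module _ {σ : ℕ} where

    hasRunParity : Bool → List (Fin σ) → Bool
    hasRunParity β l = does (isOdd (runsL l) Bool.≟ β)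

    hasRunParity-∷-≡ : ∀ β a l → hasRunParity β (a ∷ a ∷ l) ≡ hasRunParity β (a ∷ l)
    hasRunParity-∷-≡ β a l with a Fin.≟ a
    ... | yes _ = refl
    ... | no a≢a = ⊥-elim (a≢a refl)

    hasRunParity-∷-≢ : ∀ β {a b} l → a ≢ b → hasRunParity β (a ∷ b ∷ l) ≡ hasRunParity (not β) (b ∷ l)
    hasRunParity-∷-≢ β {a} {b} l a≢b with a Fin.≟ b
    ... | yes a≡b = ⊥-elim (a≢b a≡b)
    ... | no _ = not-≟ (isOdd (runsL (b ∷ l))) β
      where
      not-≟ : ∀ x y → does (not x Bool.≟ y) ≡ does (x Bool.≟ not y)
      not-≟ true true = refl
      not-≟ true false = refl
      not-≟ false true = refl
      not-≟ false false = refl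

  runParityCount : ℕ → ℕ → Bool → ℕ
  runParityCount c zero β = if β then 1 else 0
  runParityCount c (suc m) β = runParityCount c m β + c * runParityCount c m (not β)

  count-hasRunParity : ∀ c m (a : Fin (suc c)) β →
    count (λ t → hasRunParity β (a ∷ toList t)) (allStrings (suc c) m) ≡ runParityCount c m β
  count-hasRunParity c zero a true = refl
  count-hasRunParity c zero a false = refl
  count-hasRunParity c (suc m) a β = begin
    count (λ t → hasRunParity β (a ∷ toList t)) (allStrings (suc c) (suc m))
      ≡⟨ count-allStrings-suc (suc c) m _ ⟩
    sum (λ b → count (λ t → hasRunParity β (a ∷ b ∷ toList t)) (allStrings (suc c) m))
      ≡⟨ ∑-single-out _ a (runParityCount c m (not β)) other ⟩
    count (λ t → hasRunParity β (a ∷ a ∷ toList t)) (allStrings (suc c) m) + c * runParityCount c m (not β)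
      ≡⟨ cong (_+ c * runParityCount c m (not β)) same ⟩
    runParityCount c m β + c * runParityCount c m (not β) ∎
    where
    open ≡-Reasoning
    same : count (λ t → hasRunParity β (a ∷ a ∷ toList t)) (allStrings (suc c) m) ≡ runParityCount c m β
    same = trans (count-cong (λ t → hasRunParity-∷-≡ β a (toList t)) (allStrings (suc c) m))
                 (count-hasRunParity c m a β)
    other : ∀ b → b ≢ a →
            count (λ t → hasRunParity β (a ∷ b ∷ toList t)) (allStrings (suc c) m) ≡ runParityCount c m (not β)
    other b b≢a = trans (count-cong (λ t → hasRunParity-∷-≢ β (toList t) (b≢a ∘ sym)) (allStrings (suc c) m))
                        (count-hasRunParity c m b (not β))

  runParityCount-sum : ∀ c m → runParityCount c m true + runParityCount c m false ≡ suc c ^ m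
  runParityCount-sum c zero = refl
  runParityCount-sum c (suc m) = begin
    (f + c * g) + (g + c * f) ≡⟨ solve 3 (λ f g c → (f :+ c :* g) :+ (g :+ c :* f) := (con 1 :+ c) :* (f :+ g)) refl f g c ⟩
    suc c * (f + g)           ≡⟨ cong (suc c *_) (runParityCount-sum c m) ⟩
    suc c * suc c ^ m         ∎
    where
    open ≡-Reasoning
    open ℕ-Solver.+-*-Solver
    f = runParityCount c m true
    g = runParityCount c m false

  runParityCount-difference : ∀ c m →
    + runParityCount c m true ℤ.- + runParityCount c m false ≡ (+ 2 ℤ.- + suc c) ℤ.^ m
  runParityCount-difference c zero = refl
  runParityCount-difference c (suc m) = begin
    + (f + c * g) ℤ.- + (g + c * f)
      ≡⟨ cong₂ ℤ._-_ (trans (pos-+ f (c * g)) (cong (ℤ._+_ (+ f)) (pos-* c g)))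
                     (trans (pos-+ g (c * f)) (cong (ℤ._+_ (+ g)) (pos-* c f))) ⟩
    (+ f ℤ.+ + c ℤ.* + g) ℤ.- (+ g ℤ.+ + c ℤ.* + f)
      ≡⟨ solve 3 (λ f g c → (f :+ c :* g) :- (g :+ c :* f) := (con (+ 2) :- (con (+ 1) :+ c)) :* (f :- g))
               refl (+ f) (+ g) (+ c) ⟩
    (+ 2 ℤ.- (+ 1 ℤ.+ + c)) ℤ.* (+ f ℤ.- + g)
      ≡⟨ cong₂ (λ n z → (+ 2 ℤ.- n) ℤ.* z) (sym (pos-+ 1 c)) (runParityCount-difference c m) ⟩
    (+ 2 ℤ.- + suc c) ℤ.* (+ 2 ℤ.- + suc c) ℤ.^ m ∎
    where
    open ≡-Reasoning
    open ℤ-Solver.+-*-Solver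
    f = runParityCount c m true
    g = runParityCount c m false

  runParityCount-twice : ∀ c m →
    + runParityCount c m true ℤ.+ + runParityCount c m true ≡ + (suc c ^ m) ℤ.+ (+ 2 ℤ.- + suc c) ℤ.^ m
  runParityCount-twice c m = begin
    + f ℤ.+ + f                     ≡⟨ solve 2 (λ f g → f :+ f := (f :+ g) :+ (f :- g)) refl (+ f) (+ g) ⟩
    (+ f ℤ.+ + g) ℤ.+ (+ f ℤ.- + g) ≡⟨ cong₂ ℤ._+_ (trans (sym (pos-+ f g)) (cong +_ (runParityCount-sum c m)))
                                                   (runParityCount-difference c m) ⟩
    + (suc c ^ m) ℤ.+ (+ 2 ℤ.- + suc c) ℤ.^ m ∎
    where
    open ≡-Reasoning
    open ℤ-Solver.+-*-Solver
    f = runParityCount c m true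
    g = runParityCount c m false

  kernel≡ᵇ1 : ∀ {σ n} (s : Vec (Fin σ) n) → (distinct (kernel s) ≡ᵇ 1) ≡ hasRunParity true (toList s)
  kernel≡ᵇ1 s rewrite distinct-kernel s with isOdd (runs s)
  ... | true = refl
  ... | false = refl

  count-kernel : ∀ c m →
    count (λ s → distinct (kernel s) ≡ᵇ 1) (allStrings (suc c) (suc m)) ≡ suc c * runParityCount c m true
  count-kernel c m = trans (count-allStrings-suc (suc c) m _) (∑-const (suc c) (runParityCount c m true)
    (λ a → trans (count-cong (λ t → kernel≡ᵇ1 (a ∷ᵥ t)) (allStrings (suc c) m)) (count-hasRunParity c m a true)))

module Fractions where

  open import Defs using (frac; _^ℚ_)
  open import Data.Integer as ℤ using (+_)
  open import Data.Integer.Properties using (pos-*; *-identityˡ; *-identityʳ)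
  import Data.Integer.Solver as ℤ-Solver
  open import Data.Nat using (ℕ; zero; suc; _*_; _^_; _<_; z≤n; s≤s)
  open import Data.Nat.Properties using (m^n>0; n≤1+n)
  import Data.Nat.Properties as ℕₚ
  open import Data.Rational as ℚ using (ℚ; ½; 1ℚ; toℚᵘ; ∣_∣)
  open import Data.Rational.Properties
    using (toℚᵘ-injective; toℚᵘ-fromℚᵘ; toℚᵘ-homo-*; toℚᵘ-homo-+; toℚᵘ-homo-∣-∣; toℚᵘ-cancel-<)
  open import Data.Rational.Unnormalised as ℚᵘ using (ℚᵘ; mkℚᵘ; ↥_; ↧_; ↧ₙ_; _≃_; *≡*; *<*)
  open import Data.Rational.Unnormalised.Properties
    using (≃-refl; ≃-sym; ≃-trans; *-cong; *-congˡ; +-congʳ; ∣-∣-cong; <-respˡ-≃)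
  open import Relation.Binary.PropositionalEquality

  -- Powers are computed in ℚᵘ, where numerator and denominator of a product are
  -- the products of those of the factors.
  _^ᵘ_ : ℚᵘ → ℕ → ℚᵘ
  p ^ᵘ zero = ℚᵘ.1ℚᵘ
  p ^ᵘ suc m = p ℚᵘ.* p ^ᵘ m

  toℚᵘ-^ : ∀ p m → toℚᵘ (p ^ℚ m) ≃ toℚᵘ p ^ᵘ m
  toℚᵘ-^ p zero = ≃-refl
  toℚᵘ-^ p (suc m) = ≃-trans (toℚᵘ-homo-* p (p ^ℚ m)) (*-congˡ {toℚᵘ p} (toℚᵘ-^ p m))

  ^ᵘ-cong : ∀ {p q} m → p ≃ q → p ^ᵘ m ≃ q ^ᵘ m
  ^ᵘ-cong zero p≃q = ≃-refl
  ^ᵘ-cong (suc m) p≃q = *-cong p≃q (^ᵘ-cong m p≃q)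

  ↥-* : ∀ p q → ↥ (p ℚᵘ.* q) ≡ ↥ p ℤ.* ↥ q
  ↥-* (mkℚᵘ _ _) (mkℚᵘ _ _) = refl

  ↧ₙ-* : ∀ p q → ↧ₙ (p ℚᵘ.* q) ≡ ↧ₙ p * ↧ₙ q
  ↧ₙ-* (mkℚᵘ _ _) (mkℚᵘ _ _) = refl

  ↥-^ᵘ : ∀ p m → ↥ (p ^ᵘ m) ≡ ↥ p ℤ.^ m
  ↥-^ᵘ p zero = refl
  ↥-^ᵘ p (suc m) = trans (↥-* p (p ^ᵘ m)) (cong (↥ p ℤ.*_) (↥-^ᵘ p m))

  ↧ₙ-^ᵘ : ∀ p m → ↧ₙ (p ^ᵘ m) ≡ ↧ₙ p ^ m
  ↧ₙ-^ᵘ p zero = refl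
  ↧ₙ-^ᵘ p (suc m) = trans (↧ₙ-* p (p ^ᵘ m)) (cong (↧ₙ p *_) (↧ₙ-^ᵘ p m))

  ↥-½*[1+p] : ∀ p → ↥ (ℚᵘ.½ ℚᵘ.* (ℚᵘ.1ℚᵘ ℚᵘ.+ p)) ≡ ↧ p ℤ.+ ↥ p
  ↥-½*[1+p] (mkℚᵘ n d) = solve 2 (λ n d → con (+ 1) :* (con (+ 1) :* d :+ n :* con (+ 1)) := d :+ n) refl n (+ suc d)
    where open ℤ-Solver.+-*-Solver

  ↧ₙ-½*[1+p] : ∀ p → ↧ₙ (ℚᵘ.½ ℚᵘ.* (ℚᵘ.1ℚᵘ ℚᵘ.+ p)) ≡ 2 * ↧ₙ p
  ↧ₙ-½*[1+p] (mkℚᵘ n d) = cong (2 *_) (ℕₚ.*-identityˡ (suc d))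

  toℚᵘ-frac : ∀ a d → toℚᵘ (frac a (suc d)) ≃ mkℚᵘ a d
  toℚᵘ-frac a d = toℚᵘ-fromℚᵘ (mkℚᵘ a d)

  frac-≡ : ∀ a n {q : ℚ} (p : ℚᵘ) → 0 < n → toℚᵘ q ≃ p → a ℤ.* ↧ p ≡ ↥ p ℤ.* + n → frac a n ≡ q
  frac-≡ a (suc d) p _ q≃p a↧p≡↥pn =
    toℚᵘ-injective (≃-trans (toℚᵘ-frac a d) (≃-trans (*≡* a↧p≡↥pn) (≃-sym q≃p)))

  frac-½*[1+^] : ∀ q d m F → + F ℤ.+ + F ≡ + (suc d ^ m) ℤ.+ q ℤ.^ m →
                 frac (+ (suc d * F)) (suc d ^ suc m) ≡ ½ ℚ.* (1ℚ ℚ.+ frac q (suc d) ^ℚ m)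
  frac-½*[1+^] q d m F 2F≡ = frac-≡ (+ (b * F)) (b ^ suc m) P (m^n>0 b (suc m)) rhs≃P cross
    where
    b = suc d
    Y = mkℚᵘ q d ^ᵘ m
    P = ℚᵘ.½ ℚᵘ.* (ℚᵘ.1ℚᵘ ℚᵘ.+ Y)
    rhs≃P : toℚᵘ (½ ℚ.* (1ℚ ℚ.+ frac q b ^ℚ m)) ≃ P
    rhs≃P = ≃-trans (toℚᵘ-homo-* ½ (1ℚ ℚ.+ frac q b ^ℚ m))
              (*-congˡ {ℚᵘ.½} (≃-trans (toℚᵘ-homo-+ 1ℚ (frac q b ^ℚ m))
                (+-congʳ ℚᵘ.1ℚᵘ (≃-trans (toℚᵘ-^ (frac q b) m) (^ᵘ-cong m (toℚᵘ-frac q d))))))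
    cross : + (b * F) ℤ.* ↧ P ≡ ↥ P ℤ.* + (b ^ suc m)
    cross = begin
      + (b * F) ℤ.* + ↧ₙ P
        ≡⟨ cong₂ ℤ._*_ (pos-* b F) (cong +_ (trans (↧ₙ-½*[1+p] Y) (cong (2 *_) (↧ₙ-^ᵘ (mkℚᵘ q d) m)))) ⟩
      (+ b ℤ.* + F) ℤ.* + (2 * b ^ m)
        ≡⟨ cong ((+ b ℤ.* + F) ℤ.*_) (pos-* 2 (b ^ m)) ⟩
      (+ b ℤ.* + F) ℤ.* (+ 2 ℤ.* + (b ^ m))
        ≡⟨ solve 3 (λ b f B → (b :* f) :* (con (+ 2) :* B) := (f :+ f) :* (b :* B)) refl (+ b) (+ F) (+ (b ^ m)) ⟩
      (+ F ℤ.+ + F) ℤ.* (+ b ℤ.* + (b ^ m))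
        ≡⟨ cong₂ ℤ._*_ 2F≡ (sym (pos-* b (b ^ m))) ⟩
      (+ (b ^ m) ℤ.+ q ℤ.^ m) ℤ.* + (b ^ suc m)
        ≡⟨ cong (ℤ._* + (b ^ suc m)) (sym ↥P) ⟩
      ↥ P ℤ.* + (b ^ suc m) ∎
      where
      open ≡-Reasoning
      open ℤ-Solver.+-*-Solver
      ↥P : ↥ P ≡ + (b ^ m) ℤ.+ q ℤ.^ m
      ↥P = trans (↥-½*[1+p] Y) (cong₂ ℤ._+_ (cong +_ (↧ₙ-^ᵘ (mkℚᵘ q d) m)) (↥-^ᵘ (mkℚᵘ q d) m))

  ∣frac∣<1 : ∀ a d → ℤ.∣ a ∣ < suc d → ∣ frac a (suc d) ∣ ℚ.< 1ℚ
  ∣frac∣<1 a d ∣a∣<b = toℚᵘ-cancel-< (<-respˡ-≃ (≃-sym toℚᵘ∣x∣≃) (*<* ∣a∣·1<1·b))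
    where
    toℚᵘ∣x∣≃ : toℚᵘ ∣ frac a (suc d) ∣ ≃ ℚᵘ.∣ mkℚᵘ a d ∣
    toℚᵘ∣x∣≃ = ≃-trans (toℚᵘ-homo-∣-∣ (frac a (suc d))) (∣-∣-cong (toℚᵘ-frac a d))
    ∣a∣·1<1·b : + ℤ.∣ a ∣ ℤ.* + 1 ℤ.< + 1 ℤ.* + suc d
    ∣a∣·1<1·b = subst₂ ℤ._<_ (sym (*-identityʳ _)) (sym (*-identityˡ _)) (ℤ.+<+ ∣a∣<b)

  ∣2-σ∣<σ : ∀ τ → ℤ.∣ + 2 ℤ.- + suc (suc τ) ∣ < suc (suc τ)
  ∣2-σ∣<σ zero = s≤s z≤n
  ∣2-σ∣<σ (suc τ) = s≤s (s≤s (n≤1+n τ))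

open import Defs
open import Data.Bool using (true)
open import Data.Nat using (ℕ; suc; _^_; _≤_; _∸_; _≡ᵇ_; z≤n; s≤s)
open import Data.Fin using (Fin)
open import Data.Vec using (Vec)
open import Data.Integer using (+_)
open import Data.Rational using (½; 1ℚ; _+_; _*_; _<_; ∣_∣)
open import Data.Rational.Properties using (*-zeroˡ)
open import Data.Product using (_×_; _,_)
open import Function.Bundles using (_⇔_)
open import Relation.Binary.PropositionalEquality using (_≡_; refl; trans; cong)
open import Relation.Nullary using (¬_)
open Peeling using (distinct-kernel-parity)
open Counting using (count-kernel; runParityCount; runParityCount-twice)
open Fractions using (frac-½*[1+^]; ∣frac∣<1; ∣2-σ∣<σ)

prob-kernel : ∀ c m →
  prob (suc c) (suc m) (λ s → distinct (kernel s) ≡ᵇ 1) ≡ ½ * (1ℚ + frac (+ 2 Data.Integer.- + suc c) (suc c) ^ℚ m)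
prob-kernel c m = trans (cong (λ k → frac (+ k) (suc c ^ suc m)) (count-kernel c m))
  (frac-½*[1+^] (+ 2 Data.Integer.- + suc c) c m (runParityCount c m true) (runParityCount-twice c m))

mainTheorem15 : (n σ : ℕ) → 2 ≤ n → 2 ≤ σ →
    -- per-string characterisation of the number of distinct kernel symbols
    ((s : Vec (Fin σ) n) →
        (distinct (kernel s) ≡ 1 ⇔ Odd (runs s))
      × (Odd (runs s) ⇔ Even (runs s ∸ 1))
      × (¬ Odd (runs s) → distinct (kernel s) ≡ 2))
    -- probability formula, with q = (2 - σ) / σ
    × (prob σ n (λ s → distinct (kernel s) ≡ᵇ 1)
         ≡ ½ * (1ℚ + (frac (+ 2 Data.Integer.- + σ) σ ^ℚ (n ∸ 1))))
    -- equals 1/2 exactly for σ = 2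
    × (σ ≡ 2 → prob σ n (λ s → distinct (kernel s) ≡ᵇ 1) ≡ ½)
    -- for σ ≥ 3 the deviation from 1/2 is |q|^(n-1) with |q| < 1
    × (3 ≤ σ → ∣ frac (+ 2 Data.Integer.- + σ) σ ∣ < 1ℚ)
mainTheorem15 (suc (suc m)) (suc (suc τ)) (s≤s (s≤s z≤n)) (s≤s (s≤s z≤n)) =
  distinct-kernel-parity , prob-kernel (suc τ) (suc m) , binary , λ _ → ∣frac∣<1 q (suc τ) (∣2-σ∣<σ τ)
  where
  q = + 2 Data.Integer.- + suc (suc τ)
  binary : suc (suc τ) ≡ 2 → prob (suc (suc τ)) (suc (suc m)) (λ s → distinct (kernel s) ≡ᵇ 1) ≡ ½
  binary refl = trans (prob-kernel 1 (suc m)) (cong (λ z → ½ * (1ℚ + z)) (*-zeroˡ (frac (+ 0) 2 ^ℚ m)))
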